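{- Let $r:X\looparrowright Y$ be a weakening relation between posets, and let $X\xrightarrow{j}R\xleftarrow{k}Y$ be its collage. Define $\overline{\mathbbm{2}}(r)=(\mathbbm{2}^k)_\ast\cdot(\mathbbm{2}^j)^\ast:\mathbbm{2}^X\looparrowright\mathbbm{2}^Y$, where $\mathbbm{2}^j:\mathbbm{2}^R\to\mathbbm{2}^X$ and $\mathbbm{2}^k:\mathbbm{2}^R\to\mathbbm{2}^Y$ are precomposition; explicitly, $(A,B)\in\overline{\mathbbm{2}}(r)$ iff there is an up-set $C\in\mathbbm{2}^R$ with $A\subseteq \mathbbm{2}^j(C)$ and $\mathbbm{2}^k(C)\subseteq B$. Then for all up-sets $A\in\mathbbm{2}^X$, $B\in\mathbbm{2}^Y$: $(A,B)\in\overline{\mathbbm{2}}(r)$ if and only if for all $a\in X$ and $b\in Y$, $a\in A$ and $a\,r\,b$ imply $b\in B$.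
   Context: $\mathbbm{2}=\{0<1\}$; for a poset $P$, $\mathbbm{2}^P$ is the poset of monotone maps $P\to\mathbbm{2}$, identified with up-sets ordered by inclusion. A weakening relation $r:X\looparrowright Y$ is a subset of $X\times Y$ with $x'\le x\,r\,y\le y'\Rightarrow x'ry'$. The collage of $r$ is the poset $R$ on the disjoint union $X\sqcup Y$ whose order restricts to the orders of $X$ and $Y$ and has $x\le y$ iff $x\,r\,y$ for $x\in X,y\in Y$ (and never $y\le x$), with $j,k$ the inclusions. For monotone $f:P\to Q$: $f_\ast=\{(p,q)\mid f(p)\le q\}:P\looparrowright Q$ and $f^\ast=\{(q,p)\mid q\le f(p)\}:Q\looparrowright P$; $S\cdot T$ denotes relational composition with $T$ first. -}

module Defs where

open import Level using (Level; _⊔_; Lift; lift)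
open import Data.Empty using (⊥)
open import Data.Bool using (Bool; true; false) renaming (_≤_ to _≤ᵇ_)
open import Data.Product using (Σ; Σ-syntax; ∃-syntax; _×_; _,_; proj₁; proj₂)
open import Data.Sum using (_⊎_; inj₁; inj₂)
open import Data.Sum.Relation.Binary.Pointwise using (Pointwise; inj₁; inj₂; ⊎-isEquivalence)
open import Relation.Binary.Bundles using (Poset)
open import Relation.Binary.Structures using (IsPartialOrder; IsPreorder)

-- 𝟚 = Bool with false < true (Data.Bool._≤_).
-- 𝟚^P : monotone maps P → 𝟚 (identified with up-sets), ordered pointwise.
module _ {c ℓ₁ ℓ₂ : Level} (P : Poset c ℓ₁ ℓ₂) where
  open Poset P

  Monotone2 : (Carrier → Bool) → Set (c ⊔ ℓ₂)
  Monotone2 f = ∀ {x y} → x ≤ y → f x ≤ᵇ f y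

  UpSet : Set (c ⊔ ℓ₂)
  UpSet = Σ (Carrier → Bool) Monotone2

  _∈_ : Carrier → UpSet → Set
  x ∈ A = proj₁ A x ≡ᵇ true
    where open import Relation.Binary.PropositionalEquality renaming (_≡_ to _≡ᵇ_)

  _⊑_ : UpSet → UpSet → Set c
  A ⊑ B = ∀ x → proj₁ A x ≤ᵇ proj₁ B x

record Weakening {a ℓa ℓa' b ℓb ℓb' : Level} (X : Poset a ℓa ℓa') (Y : Poset b ℓb ℓb') (ℓ : Level)
       : Set (a ⊔ ℓa' ⊔ b ⊔ ℓb' ⊔ Level.suc ℓ) where
  private
    module X = Poset X
    module Y = Poset Y
  field
    rel : X.Carrier → Y.Carrier → Set ℓ
    weaken : ∀ {x' x y y'} → x' X.≤ x → rel x y → y Y.≤ y' → rel x' y'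
open Weakening public

module Collage {a ℓa ℓa' b ℓb ℓb' ℓ : Level} {X : Poset a ℓa ℓa'} {Y : Poset b ℓb ℓb'}
               (r : Weakening X Y ℓ) where
  private
    module X = Poset X
    module Y = Poset Y

  _≤C_ : X.Carrier ⊎ Y.Carrier → X.Carrier ⊎ Y.Carrier → Set (ℓa' ⊔ ℓb' ⊔ ℓ)
  inj₁ x ≤C inj₁ x' = Lift (ℓb' ⊔ ℓ) (x X.≤ x')
  inj₂ y ≤C inj₂ y' = Lift (ℓa' ⊔ ℓ) (y Y.≤ y')
  inj₁ x ≤C inj₂ y  = Lift (ℓa' ⊔ ℓb') (rel r x y)
  inj₂ y ≤C inj₁ x  = Lift (ℓa' ⊔ ℓb' ⊔ ℓ) ⊥

  private
    _≈C_ = Pointwise X._≈_ Y._≈_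

    refl' : ∀ {u v} → u ≈C v → u ≤C v
    refl' (inj₁ e) = lift (X.reflexive e)
    refl' (inj₂ e) = lift (Y.reflexive e)

    trans' : ∀ {u v w} → u ≤C v → v ≤C w → u ≤C w
    trans' {inj₁ _} {inj₁ _} {inj₁ _} (lift p) (lift q) = lift (X.trans p q)
    trans' {inj₁ _} {inj₁ _} {inj₂ _} (lift p) (lift q) = lift (weaken r p q Y.refl)
    trans' {inj₁ _} {inj₂ _} {inj₁ _} _ (lift ())
    trans' {inj₁ _} {inj₂ _} {inj₂ _} (lift p) (lift q) = lift (weaken r X.refl p q)
    trans' {inj₂ _} {inj₁ _} {_} (lift ()) _
    trans' {inj₂ _} {inj₂ _} {inj₁ _} _ (lift ())
    trans' {inj₂ _} {inj₂ _} {inj₂ _} (lift p) (lift q) = lift (Y.trans p q)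

    antisym' : ∀ {u v} → u ≤C v → v ≤C u → u ≈C v
    antisym' {inj₁ _} {inj₁ _} (lift p) (lift q) = inj₁ (X.antisym p q)
    antisym' {inj₁ _} {inj₂ _} _ (lift ())
    antisym' {inj₂ _} {inj₁ _} (lift ()) _
    antisym' {inj₂ _} {inj₂ _} (lift p) (lift q) = inj₂ (Y.antisym p q)

  R : Poset (a ⊔ b) (a ⊔ b ⊔ ℓa ⊔ ℓb) (ℓa' ⊔ ℓb' ⊔ ℓ)
  R = record
    { Carrier = X.Carrier ⊎ Y.Carrier
    ; _≈_ = _≈C_
    ; _≤_ = _≤C_
    ; isPartialOrder = record
      { isPreorder = record
        { isEquivalence = ⊎-isEquivalence X.isEquivalence Y.isEquivalence
        ; reflexive = refl'
        ; trans = trans' }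
      ; antisym = antisym' } }

  j : X.Carrier → X.Carrier ⊎ Y.Carrier
  j = inj₁

  k : Y.Carrier → X.Carrier ⊎ Y.Carrier
  k = inj₂

  2^j : UpSet R → UpSet X
  2^j (C , m) = (λ x → C (j x)) , (λ p → m (lift p))

  2^k : UpSet R → UpSet Y
  2^k (C , m) = (λ y → C (k y)) , (λ p → m (lift p))

  -- f_* = {(p,q) | f p ≤ q},  f^* = {(q,p) | q ≤ f p}
  -- 2̄(r) = (𝟚^k)_* · (𝟚^j)^* : (A,B) ∈ 2̄(r) iff ∃ C. A ⊑ 𝟚^j C and 𝟚^k C ⊑ B
  2̄ : UpSet X → UpSet Y → Set (a ⊔ b ⊔ ℓa' ⊔ ℓb' ⊔ ℓ)
  2̄ A B = Σ[ C ∈ UpSet R ] (_⊑_ X A (2^j C) × _⊑_ Y (2^k C) B)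

module Submission where

open import Defs
open import Level using (Level; _⊔_; lift)
open import Relation.Binary.Bundles using (Poset)
open import Function.Bundles using (_⇔_; mk⇔)
open import Data.Bool using (Bool; true; false; b≤b; f≤t) renaming (_≤_ to _≤ᵇ_)
open import Data.Bool.Properties using () renaming (≤-refl to ≤ᵇ-refl)
open import Data.Product using (_,_)
open import Data.Sum using (_⊎_; inj₁; inj₂)
open import Relation.Binary.PropositionalEquality using (_≡_; refl)

-- An up-set C of the collage witnessing (A , B) ∈ 2̄(r) gives x ∈ A ⇒ j x ∈ C ⇒ k y ∈ C ⇒ y ∈ B
-- whenever x r y. Conversely the largest candidate, A on X glued to B on Y, is an up-set of
-- the collage exactly when r carries A into B, and it restricts to A and to B.

≤ᵇ⇒true⇒true : ∀ {a b} → a ≤ᵇ b → a ≡ true → b ≡ true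
≤ᵇ⇒true⇒true b≤b refl = refl

true⇒true⇒≤ᵇ : ∀ {a b} → (a ≡ true → b ≡ true) → a ≤ᵇ b
true⇒true⇒≤ᵇ {false} {false} _ = b≤b
true⇒true⇒≤ᵇ {false} {true}  _ = f≤t
true⇒true⇒≤ᵇ {true}          h with h refl
... | refl = b≤b

module _ {c ℓ₁ ℓ₂ : Level} (P : Poset c ℓ₁ ℓ₂) where
  open Poset P

  ∈-upward : ∀ {x y} (A : UpSet P) → x ≤ y → _∈_ P x A → _∈_ P y A
  ∈-upward (_ , monotone) x≤y = ≤ᵇ⇒true⇒true (monotone x≤y)

  ⊑⇒⊆ : ∀ {A B : UpSet P} → _⊑_ P A B → ∀ {x} → _∈_ P x A → _∈_ P x B
  ⊑⇒⊆ A⊑B {x} = ≤ᵇ⇒true⇒true (A⊑B x)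

  ⊑-refl : ∀ {A : UpSet P} → _⊑_ P A A
  ⊑-refl _ = ≤ᵇ-refl

module _ {a ℓa ℓa' b ℓb ℓb' ℓ : Level} {X : Poset a ℓa ℓa'} {Y : Poset b ℓb ℓb'}
         (r : Weakening X Y ℓ) where
  open Collage r
  private
    module X = Poset X
    module Y = Poset Y

  Carries : UpSet X → UpSet Y → Set (a ⊔ b ⊔ ℓ)
  Carries A B = ∀ (x : X.Carrier) (y : Y.Carrier) → _∈_ X x A → rel r x y → _∈_ Y y B

  2̄⇒carries : ∀ A B → 2̄ A B → Carries A B
  2̄⇒carries A B (C , A⊑C∘j , C∘k⊑B) x y x∈A rxy =
    ⊑⇒⊆ Y {2^k C} {B} C∘k⊑B
      (∈-upward R C (lift rxy) (⊑⇒⊆ X {A} {2^j C} A⊑C∘j x∈A))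

  collage-upSet : (A : UpSet X) (B : UpSet Y) → Carries A B → UpSet R
  collage-upSet (A , monotoneA) (B , monotoneB) carries = [A,B] , monotone
    where
    [A,B] : X.Carrier ⊎ Y.Carrier → Bool
    [A,B] (inj₁ x) = A x
    [A,B] (inj₂ y) = B y

    monotone : Monotone2 R [A,B]
    monotone {inj₁ _} {inj₁ _} (lift x≤x') = monotoneA x≤x'
    monotone {inj₂ _} {inj₂ _} (lift y≤y') = monotoneB y≤y'
    monotone {inj₁ x} {inj₂ y} (lift rxy)  = true⇒true⇒≤ᵇ (λ x∈A → carries x y x∈A rxy)
    monotone {inj₂ _} {inj₁ _} (lift ())

  carries⇒2̄ : ∀ A B → Carries A B → 2̄ A B
  carries⇒2̄ A B carries = collage-upSet A B carries , ⊑-refl X {A} , ⊑-refl Y {B}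

proposition4p4 : {a ℓa ℓa' b ℓb ℓb' ℓ : Level} {X : Poset a ℓa ℓa'} {Y : Poset b ℓb ℓb'}
    (r : Weakening X Y ℓ) (A : UpSet X) (B : UpSet Y) →
    Collage.2̄ r A B ⇔ (∀ (x : Poset.Carrier X) (y : Poset.Carrier Y) → _∈_ X x A → rel r x y → _∈_ Y y B)
proposition4p4 r A B = mk⇔ (2̄⇒carries r A B) (carries⇒2̄ r A B)
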